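{- Let $G$ be a graph and $f$ an SEDF of $G$. If $G$ contains a cycle $C_n$ as a subgraph, then $\sum_{v\in V(C_n)} s_v\geq 0$.
   Context: All graphs are finite, simple and undirected. For a vertex $v$, $E(v)$ is the set of edges incident with $v$, and $s_v=\sum_{e\in E(v)}f(e)$. For an edge $e=uv$, $N[e]$ denotes the set of edges of $G$ sharing at least one endpoint with $e$ (including $e$ itself). A function $f:E(G)\to\{ -1,1\}$ is a signed edge domination function (SEDF) if $\sum_{e'\in N[e]}f(e')\geq 1$ for every $e\in E(G)$. -}

module Defs where

open import Data.Nat using (ℕ; zero; suc; _<ᵇ_)
open import Data.Fin using (Fin; toℕ; _≟_)
open import Data.Fin.Base using (zero; suc; inject₁; fromℕ)
open import Data.Bool using (Bool; true; false; _∧_; _∨_; if_then_else_)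
open import Data.Integer using (ℤ; _+_; 0ℤ; 1ℤ; -1ℤ; _≤_)
open import Data.List using (List; []; _∷_; concatMap; filter; map; foldr; allFin)
open import Data.Product using (_×_; _,_; proj₁; proj₂)
open import Data.Sum using (_⊎_)
open import Relation.Binary.PropositionalEquality using (_≡_)
open import Relation.Nullary.Decidable using (⌊_⌋)
open import Function.Definitions using (Injective)

record Graph (n : ℕ) : Set where
  field
    adj   : Fin n → Fin n → Bool
    sym   : ∀ u v → adj u v ≡ adj v u
    irref : ∀ v → adj v v ≡ false
open Graph public

Edge : ℕ → Set
Edge n = Fin n × Fin n

-- Each edge {u,v} is listed exactly once, as the pair (u , v) with u < v.
edges : ∀ {n} → Graph n → List (Edge n)
edges {n} G = concatMap (λ u → concatMap (λ v →
  if adj G u v ∧ (toℕ u <ᵇ toℕ v) then (u , v) ∷ [] else []) (allFin n)) (allFin n)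

_==_ : ∀ {n} → Fin n → Fin n → Bool
a == b = ⌊ a ≟ b ⌋

incident : ∀ {n} → Fin n → Edge n → Bool
incident v (a , b) = (v == a) ∨ (v == b)

adjacentEdges : ∀ {n} → Edge n → Edge n → Bool
adjacentEdges (a , b) e' = incident a e' ∨ incident b e'

sumℤ : List ℤ → ℤ
sumℤ = foldr _+_ 0ℤ

-- an edge labelling (only its values on edges of G matter)
EdgeFun : ℕ → Set
EdgeFun n = Edge n → ℤ

s : ∀ {n} → Graph n → EdgeFun n → Fin n → ℤ
s G f v = sumℤ (map f (filter (λ e → Data.Bool._≟_ (incident v e) true) (edges G)))

closedNbhdSum : ∀ {n} → Graph n → EdgeFun n → Edge n → ℤ
closedNbhdSum G f e = sumℤ (map f (filter (λ e' → Data.Bool._≟_ (adjacentEdges e e') true) (edges G)))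

_∈E_ : ∀ {n} → Edge n → Graph n → Set
e ∈E G = Data.List.Membership.Propositional._∈_ e (edges G)
  where import Data.List.Membership.Propositional

record IsSEDF {n : ℕ} (G : Graph n) (f : EdgeFun n) : Set where
  field
    signs : ∀ e → e ∈E G → (f e ≡ 1ℤ) ⊎ (f e ≡ -1ℤ)
    dom   : ∀ e → e ∈E G → 1ℤ ≤ closedNbhdSum G f e

-- G contains the cycle C_k (k = m + 3 ≥ 3) as a subgraph, via the injective
-- vertex map c : consecutive vertices c i, c (i+1) and c (k-1), c 0 are adjacent.
record CycleIn {n : ℕ} (G : Graph n) (m : ℕ) (c : Fin (suc (suc (suc m))) → Fin n) : Set where
  field
    inj     : Injective _≡_ _≡_ c
    step    : ∀ (i : Fin (suc (suc m))) → adj G (c (inject₁ i)) (c (suc i)) ≡ true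
    closing : adj G (c (fromℕ (suc (suc m)))) (c zero) ≡ true

sumFin : ∀ k → (Fin k → ℤ) → ℤ
sumFin k g = sumℤ (map g (allFin k))

module Submission where

-- For an edge e = ab of G, the edges incident with a or b are exactly
-- N[e]; in s_a + s_b each of them is counted once, except e itself, which is incident
-- with both endpoints and is counted twice.  By inclusion–exclusion
--     s_a + s_b = Σ_{e' ∈ N[e]} f(e') + f(e) ≥ 1 + (-1) = 0        (edge inequality).
-- Adding the edge inequality over the k edges of the cycle counts every cycle vertex
-- exactly twice, so 2 · Σ_{v ∈ V(C)} s_v ≥ 0, and the claim follows.

open import Defs hiding (sym)
open import Data.Nat as ℕ using (ℕ; suc; zero; _<ᵇ_)
import Data.Nat.Properties as ℕP
open import Data.Fin using (Fin; toℕ; inject₁; fromℕ; _≟_)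
open import Data.Fin.Properties using (toℕ-injective; suc-injective)
open import Data.Bool using (Bool; true; false; _∧_; _∨_; if_then_else_)
open import Data.Bool.Properties using (∨-zeroʳ; T-≡)
open import Data.Integer as ℤ using (ℤ; _≤_; 0ℤ; -1ℤ; _+_; -[1+_]; +≤+; -≤+)
open import Data.Integer.Properties using (+-identityˡ; +-identityʳ; +-comm; +-assoc; +-mono-≤; ≤-refl)
open import Data.Integer.Solver using (module +-*-Solver)
open import Data.List using (List; []; _∷_; map; filter; concatMap; allFin; _++_)
open import Data.List.Properties using (map-tabulate)
open import Data.List.Membership.Propositional using (_∈_; lose)
open import Data.List.Membership.Propositional.Properties using (∈-concatMap⁺; ∈-allFin)
open import Data.List.Relation.Unary.Any using (here)
open import Data.Product using (_×_; _,_; proj₁; proj₂)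
open import Data.Sum using (_⊎_; inj₁; inj₂)
open import Data.Empty using (⊥-elim)
open import Function using (_∘_; id; Equivalence)
open import Relation.Binary using (tri<; tri≈; tri>)
open import Relation.Binary.PropositionalEquality
open import Relation.Nullary using (yes; no; ¬_)

open +-*-Solver using (solve; con; _:+_; _:=_)
open ≡-Reasoning

indicator : Bool → ℤ → ℤ
indicator b x = if b then x else 0ℤ

indicator-∨-∧ : ∀ p q x → indicator p x + indicator q x ≡ indicator (p ∨ q) x + indicator (p ∧ q) x
indicator-∨-∧ true  true  x = refl
indicator-∨-∧ true  false x = refl
indicator-∨-∧ false true  x = +-comm 0ℤ x
indicator-∨-∧ false false x = refl

module _ {A : Set} where

  sum-filter : (p : A → Bool) (h : A → ℤ) (xs : List A) →
    sumℤ (map h (filter (λ x → p x Data.Bool.≟ true) xs)) ≡ sumℤ (map (λ x → indicator (p x) (h x)) xs)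
  sum-filter p h [] = refl
  sum-filter p h (x ∷ xs) with p x
  ... | true  = cong (h x +_) (sum-filter p h xs)
  ... | false = trans (sum-filter p h xs) (sym (+-identityˡ _))

  sum-+ : (g h : A → ℤ) (xs : List A) →
    sumℤ (map g xs) + sumℤ (map h xs) ≡ sumℤ (map (λ x → g x + h x) xs)
  sum-+ g h [] = refl
  sum-+ g h (x ∷ xs) = begin
    (g x + G) + (h x + H)  ≡⟨ solve 4 (λ a b c d → (a :+ b) :+ (c :+ d) := (a :+ c) :+ (b :+ d))
                                      refl (g x) G (h x) H ⟩
    (g x + h x) + (G + H)  ≡⟨ cong ((g x + h x) +_) (sum-+ g h xs) ⟩
    (g x + h x) + sumℤ (map (λ y → g y + h y) xs)  ∎
    where
      G = sumℤ (map g xs)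
      H = sumℤ (map h xs)

  sum-cong : {g h : A → ℤ} → (∀ x → g x ≡ h x) → (xs : List A) → sumℤ (map g xs) ≡ sumℤ (map h xs)
  sum-cong eq [] = refl
  sum-cong eq (x ∷ xs) = cong₂ _+_ (eq x) (sum-cong eq xs)

  sum-++ : (h : A → ℤ) (xs ys : List A) → sumℤ (map h (xs ++ ys)) ≡ sumℤ (map h xs) + sumℤ (map h ys)
  sum-++ h [] ys = sym (+-identityˡ _)
  sum-++ h (x ∷ xs) ys = trans (cong (h x +_) (sum-++ h xs ys)) (sym (+-assoc (h x) _ _))

  sum-concatMap : {B : Set} (h : A → ℤ) (F : B → List A) (bs : List B) →
    sumℤ (map h (concatMap F bs)) ≡ sumℤ (map (λ b → sumℤ (map h (F b))) bs)
  sum-concatMap h F [] = refl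
  sum-concatMap h F (b ∷ bs) =
    trans (sum-++ h (F b) (concatMap F bs)) (cong (sumℤ (map h (F b)) +_) (sum-concatMap h F bs))

sumFin-suc : ∀ k (g : Fin (suc k) → ℤ) → sumFin (suc k) g ≡ g Fin.zero + sumFin k (g ∘ Fin.suc)
sumFin-suc k g =
  cong (λ l → g Fin.zero + sumℤ l) (trans (map-tabulate Fin.suc g) (sym (map-tabulate id (g ∘ Fin.suc))))

sumFin-zero : ∀ k (g : Fin k → ℤ) → (∀ i → g i ≡ 0ℤ) → sumFin k g ≡ 0ℤ
sumFin-zero zero    g z = refl
sumFin-zero (suc k) g z = begin
  sumFin (suc k) g                    ≡⟨ sumFin-suc k g ⟩
  g Fin.zero + sumFin k (g ∘ Fin.suc) ≡⟨ cong₂ _+_ (z Fin.zero) (sumFin-zero k (g ∘ Fin.suc) (z ∘ Fin.suc)) ⟩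
  0ℤ                                  ∎

sumFin-single : ∀ k (g : Fin k → ℤ) j → (∀ i → ¬ i ≡ j → g i ≡ 0ℤ) → sumFin k g ≡ g j
sumFin-single (suc k) g Fin.zero z = begin
  sumFin (suc k) g                    ≡⟨ sumFin-suc k g ⟩
  g Fin.zero + sumFin k (g ∘ Fin.suc) ≡⟨ cong (g Fin.zero +_) (sumFin-zero k _ (λ i → z (Fin.suc i) λ ())) ⟩
  g Fin.zero + 0ℤ                     ≡⟨ +-identityʳ _ ⟩
  g Fin.zero                          ∎
sumFin-single (suc k) g (Fin.suc j) z = begin
  sumFin (suc k) g                    ≡⟨ sumFin-suc k g ⟩
  g Fin.zero + sumFin k (g ∘ Fin.suc) ≡⟨ cong (_+ sumFin k (g ∘ Fin.suc)) (z Fin.zero λ ()) ⟩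
  0ℤ + sumFin k (g ∘ Fin.suc)         ≡⟨ +-identityˡ _ ⟩
  sumFin k (g ∘ Fin.suc)              ≡⟨ sumFin-single k (g ∘ Fin.suc) j
                                           (λ i i≢j → z (Fin.suc i) (i≢j ∘ suc-injective)) ⟩
  g (Fin.suc j)                       ∎

sumFin-nonneg : ∀ k (g : Fin k → ℤ) → (∀ i → 0ℤ ≤ g i) → 0ℤ ≤ sumFin k g
sumFin-nonneg zero    g pos = ≤-refl
sumFin-nonneg (suc k) g pos rewrite sumFin-suc k g =
  +-mono-≤ (pos Fin.zero) (sumFin-nonneg k (g ∘ Fin.suc) (pos ∘ Fin.suc))

module _ {n : ℕ} (G : Graph n) where

  listedPair : Fin n → Fin n → Bool
  listedPair u v = adj G u v ∧ (toℕ u <ᵇ toℕ v)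

  edgeAt : Fin n → Fin n → List (Edge n)
  edgeAt u v = if listedPair u v then (u , v) ∷ [] else []

  sum-edges : (h : Edge n → ℤ) →
    sumℤ (map h (edges G)) ≡ sumFin n (λ u → sumFin n (λ v → sumℤ (map h (edgeAt u v))))
  sum-edges h =
    trans (sum-concatMap h (λ u → concatMap (edgeAt u) (allFin n)) (allFin n))
          (sum-cong (λ u → sum-concatMap h (edgeAt u) (allFin n)) (allFin n))

  edgeAt-listed : ∀ a b → adj G a b ≡ true → toℕ a ℕ.< toℕ b → edgeAt a b ≡ (a , b) ∷ []
  edgeAt-listed a b ab∈E a<b rewrite ab∈E | Equivalence.to T-≡ (ℕP.<⇒<ᵇ a<b) = refl

  edge-∈ : ∀ a b → adj G a b ≡ true → toℕ a ℕ.< toℕ b → (a , b) ∈E G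
  edge-∈ a b ab∈E a<b =
    ∈-concatMap⁺ _ (lose (∈-allFin a) (∈-concatMap⁺ _ (lose (∈-allFin b)
      (subst ((a , b) ∈_) (sym (edgeAt-listed a b ab∈E a<b)) (here refl)))))

==-refl : ∀ {n} (a : Fin n) → (a == a) ≡ true
==-refl a with a ≟ a
... | yes _ = refl
... | no a≢a = ⊥-elim (a≢a refl)

incident⇒endpoint : ∀ {n} (a u v : Fin n) → incident a (u , v) ≡ true → (a ≡ u) ⊎ (a ≡ v)
incident⇒endpoint a u v inc with a ≟ u | a ≟ v
... | yes a≡u | _       = inj₁ a≡u
... | no _    | yes a≡v = inj₂ a≡v
... | no _    | no _    with inc
... | ()

incident-both : ∀ {n} (a b u v : Fin n) → toℕ a ℕ.< toℕ b → (toℕ u <ᵇ toℕ v) ≡ true →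
  incident a (u , v) ≡ true → incident b (u , v) ≡ true → (u ≡ a) × (v ≡ b)
incident-both a b u v a<b u<v ia ib with incident⇒endpoint a u v ia | incident⇒endpoint b u v ib
... | inj₁ refl | inj₁ refl = ⊥-elim (ℕP.<-irrefl refl a<b)
... | inj₁ refl | inj₂ refl = refl , refl
... | inj₂ refl | inj₁ refl = ⊥-elim (ℕP.<-asym a<b (ℕP.<ᵇ⇒< _ _ (Equivalence.from T-≡ u<v)))
... | inj₂ refl | inj₂ refl = ⊥-elim (ℕP.<-irrefl refl a<b)

module _ {n : ℕ} (G : Graph n) (f : EdgeFun n) where

  commonTerm : Fin n → Fin n → Edge n → ℤ
  commonTerm a b e = indicator (incident a e ∧ incident b e) (f e)

  commonTerm-other : ∀ a b u v → toℕ a ℕ.< toℕ b → ¬ ((u ≡ a) × (v ≡ b)) →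
    sumℤ (map (commonTerm a b) (edgeAt G u v)) ≡ 0ℤ
  commonTerm-other a b u v a<b uv≢ab with listedPair G u v in listed
  ... | false = refl
  ... | true with incident a (u , v) in ia | incident b (u , v) in ib
  ...   | true  | true  = ⊥-elim (uv≢ab (incident-both a b u v a<b (∧-right listed) ia ib))
    where
      ∧-right : ∀ {x y} → (x ∧ y) ≡ true → y ≡ true
      ∧-right {true} y≡true = y≡true
  ...   | true  | false = refl
  ...   | false | true  = refl
  ...   | false | false = refl

  commonTerm-self : ∀ a b → adj G a b ≡ true → toℕ a ℕ.< toℕ b →
    sumℤ (map (commonTerm a b) (edgeAt G a b)) ≡ f (a , b)
  commonTerm-self a b ab∈E a<b rewrite edgeAt-listed G a b ab∈E a<b | ==-refl a | ==-refl b
    | ∨-zeroʳ (b == a) = +-identityʳ _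

  -- The edge ab is the unique edge of G incident with both a and b.
  sum-commonTerm : ∀ a b → adj G a b ≡ true → toℕ a ℕ.< toℕ b →
    sumℤ (map (commonTerm a b) (edges G)) ≡ f (a , b)
  sum-commonTerm a b ab∈E a<b = begin
    sumℤ (map (commonTerm a b) (edges G))
      ≡⟨ sum-edges G (commonTerm a b) ⟩
    sumFin n (λ u → sumFin n (λ v → term u v))
      ≡⟨ sumFin-single n _ a (λ u u≢a → sumFin-zero n _ (λ v → commonTerm-other a b u v a<b (u≢a ∘ proj₁))) ⟩
    sumFin n (λ v → term a v)
      ≡⟨ sumFin-single n _ b (λ v v≢b → commonTerm-other a b a v a<b (v≢b ∘ proj₂)) ⟩
    term a b
      ≡⟨ commonTerm-self a b ab∈E a<b ⟩
    f (a , b) ∎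
    where
      term : Fin n → Fin n → ℤ
      term u v = sumℤ (map (commonTerm a b) (edgeAt G u v))

  s-edge-identity : ∀ a b → adj G a b ≡ true → toℕ a ℕ.< toℕ b →
    s G f a + s G f b ≡ closedNbhdSum G f (a , b) + f (a , b)
  s-edge-identity a b ab∈E a<b = begin
    s G f a + s G f b
      ≡⟨ cong₂ _+_ (sum-filter (incident a) f (edges G)) (sum-filter (incident b) f (edges G)) ⟩
    sumℤ (map (λ e → indicator (incident a e) (f e)) (edges G))
      + sumℤ (map (λ e → indicator (incident b e) (f e)) (edges G))
      ≡⟨ sum-+ _ _ (edges G) ⟩
    sumℤ (map (λ e → indicator (incident a e) (f e) + indicator (incident b e) (f e)) (edges G))
      ≡⟨ sum-cong (λ e → indicator-∨-∧ (incident a e) (incident b e) (f e)) (edges G) ⟩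
    sumℤ (map (λ e → indicator (adjacentEdges (a , b) e) (f e) + commonTerm a b e) (edges G))
      ≡⟨ sym (sum-+ _ _ (edges G)) ⟩
    sumℤ (map (λ e → indicator (adjacentEdges (a , b) e) (f e)) (edges G))
      + sumℤ (map (commonTerm a b) (edges G))
      ≡⟨ cong₂ _+_ (sym (sum-filter (adjacentEdges (a , b)) f (edges G))) (sum-commonTerm a b ab∈E a<b) ⟩
    closedNbhdSum G f (a , b) + f (a , b) ∎

  edge-inequality< : IsSEDF G f → ∀ a b → adj G a b ≡ true → toℕ a ℕ.< toℕ b →
    0ℤ ≤ s G f a + s G f b
  edge-inequality< sedf a b ab∈E a<b rewrite s-edge-identity a b ab∈E a<b =
    +-mono-≤ (IsSEDF.dom sedf _ ab∈G) f≥-1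
    where
      ab∈G : (a , b) ∈E G
      ab∈G = edge-∈ G a b ab∈E a<b
      f≥-1 : -1ℤ ≤ f (a , b)
      f≥-1 with IsSEDF.signs sedf _ ab∈G
      ... | inj₁ f≡1  rewrite f≡1  = -≤+
      ... | inj₂ f≡-1 rewrite f≡-1 = ≤-refl

  edge-inequality : IsSEDF G f → ∀ a b → adj G a b ≡ true → 0ℤ ≤ s G f a + s G f b
  edge-inequality sedf a b ab∈E with ℕP.<-cmp (toℕ a) (toℕ b)
  ... | tri< a<b _ _ = edge-inequality< sedf a b ab∈E a<b
  ... | tri≈ _ a≡b _ = ⊥-elim (no-loop (toℕ-injective a≡b))
    where
      no-loop : ¬ (a ≡ b)
      no-loop refl with trans (sym ab∈E) (irref G a)
      ... | ()
  ... | tri> _ _ b<a = subst (0ℤ ≤_) (+-comm (s G f b) (s G f a))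
                          (edge-inequality< sedf b a (trans (sym (Graph.sym G a b)) ab∈E) b<a)

cycle-double-count : ∀ k (g : Fin (suc k) → ℤ) →
  sumFin k (λ i → g (inject₁ i) + g (Fin.suc i)) + (g (fromℕ k) + g Fin.zero) ≡ sumFin (suc k) g + sumFin (suc k) g
cycle-double-count zero g =
  solve 1 (λ x → con 0ℤ :+ (x :+ x) := (x :+ con 0ℤ) :+ (x :+ con 0ℤ)) refl (g Fin.zero)
cycle-double-count (suc k) g = begin
  sumFin (suc k) pairs + (g (fromℕ (suc k)) + g₀)
    ≡⟨ cong (_+ (g (fromℕ (suc k)) + g₀)) (sumFin-suc k pairs) ⟩
  ((g₀ + g₁) + P) + (last + g₀)
    ≡⟨ solve 4 (λ g₀ g₁ P last → ((g₀ :+ g₁) :+ P) :+ (last :+ g₀) := (g₀ :+ g₀) :+ (P :+ (last :+ g₁)))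
               refl g₀ g₁ P last ⟩
  (g₀ + g₀) + (P + (last + g₁))
    ≡⟨ cong ((g₀ + g₀) +_) (cycle-double-count k (g ∘ Fin.suc)) ⟩
  (g₀ + g₀) + (S + S)
    ≡⟨ solve 2 (λ g₀ S → (g₀ :+ g₀) :+ (S :+ S) := (g₀ :+ S) :+ (g₀ :+ S)) refl g₀ S ⟩
  (g₀ + S) + (g₀ + S)
    ≡⟨ sym (cong₂ _+_ (sumFin-suc (suc k) g) (sumFin-suc (suc k) g)) ⟩
  sumFin (suc (suc k)) g + sumFin (suc (suc k)) g ∎
  where
    pairs : Fin (suc k) → ℤ
    pairs i = g (inject₁ i) + g (Fin.suc i)
    g₀ g₁ last P S : ℤ
    g₀ = g Fin.zero
    g₁ = g (Fin.suc Fin.zero)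
    last = g (fromℕ (suc k))
    P = sumFin k (pairs ∘ Fin.suc)
    S = sumFin (suc k) (g ∘ Fin.suc)

halve : ∀ x → 0ℤ ≤ x + x → 0ℤ ≤ x
halve (ℤ.+ n)   _  = +≤+ ℕ.z≤n
halve -[1+ n ] ()

mainTheorem8 : ∀ {n : ℕ} (G : Graph n) (f : EdgeFun n) → IsSEDF G f →
    ∀ (m : ℕ) (c : Fin (suc (suc (suc m))) → Fin n) → CycleIn G m c →
    0ℤ ≤ sumFin (suc (suc (suc m))) (λ i → s G f (c i))
mainTheorem8 G f sedf m c cycle = halve _ (subst (0ℤ ≤_) (cycle-double-count (suc (suc m)) sv) sum≥0)
  where
    sv : Fin (suc (suc (suc m))) → ℤ
    sv i = s G f (c i)
    sum≥0 : 0ℤ ≤ sumFin (suc (suc m)) (λ i → sv (inject₁ i) + sv (Fin.suc i))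
                 + (sv (fromℕ (suc (suc m))) + sv Fin.zero)
    sum≥0 = +-mono-≤
      (sumFin-nonneg _ _ (λ i → edge-inequality G f sedf _ _ (CycleIn.step cycle i)))
      (edge-inequality G f sedf _ _ (CycleIn.closing cycle))
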